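{- Let $L=\{v\geq 3 : v\equiv 0,1 \pmod 3\}$ and $K^*_{\mathsf{DTS}}=\{v\geq 3 : \text{there exists a DTS}(v)\text{ having no } v\text{ -good sequencing}\}$. Suppose $(X,\mathcal{B})$ is a $(v,L)$-PBD and there exists a block $B_0\in\mathcal{B}$ with $|B_0|\in K^*_{\mathsf{DTS}}$. Then $v\in K^*_{\mathsf{DTS}}$.
   Context: A transitive triple is an ordered triple $(x,y,z)$ of distinct elements; it contains the directed edges $(x,y)$, $(x,z)$, $(y,z)$. A directed triple system of order $v$, DTS$(v)$, is a pair $(X,\mathcal{B})$ where $X$ is a set of $v$ points and $\mathcal{B}$ is a set of transitive triples of elements of $X$ such that every ordered pair $(a,b)$ of distinct points of $X$ occurs as a directed edge in exactly one triple of $\mathcal{B}$. A $v$-good sequencing of a DTS$(v)$ $(X,\mathcal{B})$ is a permutation $[x_1\, x_2\, \cdots\, x_v]$ of $X$ such that for no triple $(x,y,z)\in\mathcal{B}$ do we have $x=x_i$, $y=x_j$, $z=x_k$ with $i<j<k$. For a set $K$ of integers $\geq 2$, a $(v,K)$-PBD is a pair $(X,\mathcal{B})$ with $|X|=v$ and $\mathcal{B}$ a set of subsets (blocks) of $X$ such that every pair of distinct points lies in exactly one block and $|B|\in K$ for every $B\in\mathcal{B}$. -}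

module Defs where

open import Data.Nat using (ℕ; _≥_; _%_; _<_)
open import Data.Fin using (Fin; _<_)
open import Data.Fin.Subset using (Subset; _∈_; ∣_∣)
open import Data.Fin.Permutation using (Permutation′; _⟨$⟩ʳ_; _⟨$⟩ˡ_)
open import Data.Product using (Σ; ∃; _×_; _,_)
open import Data.Sum using (_⊎_)
open import Relation.Binary.PropositionalEquality using (_≡_; _≢_)
open import Relation.Nullary using (¬_)

ExactlyOne : ∀ {b} → (Fin b → Set) → Set
ExactlyOne {b} P = Σ (Fin b) λ i → P i × (∀ j → P j → j ≡ i)

record Triple (v : ℕ) : Set where
  constructor tt3
  field
    x y z : Fin v

open Triple public

DistinctTriple : ∀ {v} → Triple v → Set
DistinctTriple t = (x t ≢ y t) × (x t ≢ z t) × (y t ≢ z t)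

HasEdge : ∀ {v} → Triple v → Fin v → Fin v → Set
HasEdge t a b = ((a ≡ x t) × (b ≡ y t)) ⊎ ((a ≡ x t) × (b ≡ z t)) ⊎ ((a ≡ y t) × (b ≡ z t))

record DTS (v : ℕ) : Set where
  field
    b       : ℕ
    triple  : Fin b → Triple v
    distinct : ∀ i → DistinctTriple (triple i)
    exact   : ∀ (a c : Fin v) → a ≢ c → ExactlyOne (λ i → HasEdge (triple i) a c)

open DTS public

-- A sequencing is a permutation; σ ⟨$⟩ʳ p is the point at position p,
-- σ ⟨$⟩ˡ u is the position of point u.
-- Good: no triple (x,y,z) appears with positions of x < y < z.
GoodSequencing : ∀ {v} → DTS v → Permutation′ v → Set
GoodSequencing {v} D σ =
  ∀ i → ¬ ((σ ⟨$⟩ˡ x (triple D i)) Data.Fin.< (σ ⟨$⟩ˡ y (triple D i))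
           × (σ ⟨$⟩ˡ y (triple D i)) Data.Fin.< (σ ⟨$⟩ˡ z (triple D i)))

InKstar : ℕ → Set
InKstar v = v ≥ 3 × Σ (DTS v) λ D → ∀ (σ : Permutation′ v) → ¬ GoodSequencing D σ

InL : ℕ → Set
InL k = k ≥ 3 × ((k % 3 ≡ 0) ⊎ (k % 3 ≡ 1))

record PBD (v : ℕ) (K : ℕ → Set) : Set₁ where
  field
    b      : ℕ
    block  : Fin b → Subset v
    sizeK  : ∀ i → K ∣ block i ∣
    exact  : ∀ (p q : Fin v) → p ≢ q → ExactlyOne (λ i → (p ∈ block i) × (q ∈ block i))

module Submission where

-- Put the DTS(k) that has no good sequencing on the block B₀ and some DTS on every other block
-- (one exists, since block sizes are ≡ 0, 1 mod 3); as each pair of points lies in exactly one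
-- block, the union of these triples is a DTS(v). A good sequencing of it lists the points of B₀
-- in some order, and ranking them by that order gives a good sequencing of the DTS on B₀.
-- A DTS(n) for every n ≡ 0, 1 (mod 3) is built from DTS(3), DTS(4) and DTS(6) by a product
-- construction over ℤ/N and by a doubling construction n ↦ 2n + 1.

open import Defs
open import Data.Bool using (true; false)
open import Data.Empty using (⊥-elim)
open import Data.Fin as Fin using (Fin; zero; suc; toℕ; #_; fromℕ<; punchOut; _<_)
open import Data.Fin.Permutation using (Permutation′; _⟨$⟩ˡ_)
open import Data.Fin.Properties
  using ( _≟_; any?; all?; +↔⊎; *↔×; _<?_; <-cmp; <-irrefl; <-asym; <-trans; <⇒≢
        ; toℕ-fromℕ<; toℕ-injective; toℕ<n; injective⇒≤; punchOut-injective)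
open import Data.Fin.Subset using (Subset; _∈_; _∉_; ∣_∣)
open import Data.Fin.Subset.Properties using (⊆⊤; ∈⊤; ∣⊤∣≡n; p⊂q⇒∣p∣<∣q∣; ∣p∣≤n)
open import Data.Nat as ℕ using (ℕ; zero; suc; _+_; _*_; _∸_; _%_; _≤_; z≤n; s≤s)
open import Data.Nat.DivMod using (_/_; _mod_; m≡m%n+[m/n]*n; %-distribˡ-+; m%n%n≡m%n; [m+n]%n≡m%n; m<n⇒m%n≡m)
open import Data.Nat.Induction using (<-rec)
open import Data.Nat.Properties
  using ( ≤-trans; <⇒≤; 1+n≰n; *-suc; *-comm; +-comm; +-assoc; +-identityʳ; m+[n∸m]≡n
        ; m≤n*m; m<m+n; m≤n⇒m≤1+n; +-monoʳ-<; *-monoʳ-<)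
open import Data.Nat.Tactic.RingSolver using (solve-∀)
open import Data.Product using (Σ; ∃; ∃!; _×_; _,_; proj₁; proj₂)
open import Data.Product.Function.NonDependent.Propositional using (_×-↔_)
open import Data.Product.Properties using (,-injective)
open import Data.Sum using (_⊎_; inj₁; inj₂)
open import Data.Sum.Properties using (inj₁-injective; inj₂-injective)
open import Data.Sum.Algebra using (⊎-comm)
open import Data.Sum.Function.Propositional using (_⊎-↔_)
open import Data.Vec using (_∷_; []; lookup; here; there; tabulate)
open import Data.Vec.Functional using (foldr)
open import Data.Vec.Properties using (lookup∘tabulate; []=⇒lookup; lookup⇒[]=)
open import Data.Vec.Properties.WithK using ([]=-irrelevant)
open import Function.Base using (_∘_)
open import Function.Bundles using (_↔_; Inverse; Injection; mk↔ₛ′; mk⤖)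
open import Function.Consequences.Propositional using (strictlySurjective⇒surjective)
open import Function.Definitions using (Injective)
open import Function.Properties.Bijection using (⤖⇒↔)
open import Function.Properties.Inverse using (↔-refl; ↔-sym; ↔-trans; ↔⇒↣)
open import Relation.Binary.Definitions using (tri<; tri≈; tri>)
open import Relation.Binary.PropositionalEquality
  using (_≡_; _≢_; refl; sym; trans; cong; subst; subst₂; module ≡-Reasoning)
open import Relation.Nullary using (¬_; Dec; yes; no; does; proof; contradiction)
open import Relation.Nullary.Decidable using (¬?; _×-dec_; _⊎-dec_; _→-dec_; from-yes; dec-true)
open import Relation.Nullary.Reflects using (Reflects; invert)

private
  variable
    P Q : Set

↔-injective : (e : P ↔ Q) → Injective _≡_ _≡_ (Inverse.to e)
↔-injective e = Injection.injective (↔⇒↣ e)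

record TransitiveTriple (P : Set) : Set where
  constructor ⟨_,_,_⟩
  field
    source middle sink : P

open TransitiveTriple

mapTriple : (P → Q) → TransitiveTriple P → TransitiveTriple Q
mapTriple f ⟨ a , b , c ⟩ = ⟨ f a , f b , f c ⟩

Arc : TransitiveTriple P → P → P → Set
Arc t a c = ((a ≡ source t) × (c ≡ middle t))
          ⊎ ((a ≡ source t) × (c ≡ sink t))
          ⊎ ((a ≡ middle t) × (c ≡ sink t))

Distinct : TransitiveTriple P → Set
Distinct t = (source t ≢ middle t) × (source t ≢ sink t) × (middle t ≢ sink t)

_∈ₜ_ : P → TransitiveTriple P → Set
a ∈ₜ t = (a ≡ source t) ⊎ (a ≡ middle t) ⊎ (a ≡ sink t)

Arc-map : ∀ (f : P → Q) t {a c} → Arc t a c → Arc (mapTriple f t) (f a) (f c)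
Arc-map f ⟨ _ , _ , _ ⟩ (inj₁ (refl , refl))        = inj₁ (refl , refl)
Arc-map f ⟨ _ , _ , _ ⟩ (inj₂ (inj₁ (refl , refl))) = inj₂ (inj₁ (refl , refl))
Arc-map f ⟨ _ , _ , _ ⟩ (inj₂ (inj₂ (refl , refl))) = inj₂ (inj₂ (refl , refl))

Arc-map⁻ : ∀ {f : P → Q} → Injective _≡_ _≡_ f → ∀ t {a c} → Arc (mapTriple f t) (f a) (f c) → Arc t a c
Arc-map⁻ f-inj ⟨ _ , _ , _ ⟩ (inj₁ (p , q))        = inj₁ (f-inj p , f-inj q)
Arc-map⁻ f-inj ⟨ _ , _ , _ ⟩ (inj₂ (inj₁ (p , q))) = inj₂ (inj₁ (f-inj p , f-inj q))
Arc-map⁻ f-inj ⟨ _ , _ , _ ⟩ (inj₂ (inj₂ (p , q))) = inj₂ (inj₂ (f-inj p , f-inj q))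

Distinct-map : ∀ {f : P → Q} → Injective _≡_ _≡_ f → ∀ t → Distinct t → Distinct (mapTriple f t)
Distinct-map f-inj ⟨ _ , _ , _ ⟩ (p , q , r) = p ∘ f-inj , q ∘ f-inj , r ∘ f-inj

Arc-irreflexive : ∀ (t : TransitiveTriple P) → Distinct t → ∀ {a} → ¬ Arc t a a
Arc-irreflexive _ (p , _ , _) (inj₁ (refl , refl))        = p refl
Arc-irreflexive _ (_ , q , _) (inj₂ (inj₁ (refl , refl))) = q refl
Arc-irreflexive _ (_ , _ , r) (inj₂ (inj₂ (refl , refl))) = r refl

Arc⇒∈ₜˡ : ∀ (t : TransitiveTriple P) {a c} → Arc t a c → a ∈ₜ t
Arc⇒∈ₜˡ _ (inj₁ (p , _))        = inj₁ p
Arc⇒∈ₜˡ _ (inj₂ (inj₁ (p , _))) = inj₁ p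
Arc⇒∈ₜˡ _ (inj₂ (inj₂ (p , _))) = inj₂ (inj₁ p)

Arc⇒∈ₜʳ : ∀ (t : TransitiveTriple P) {a c} → Arc t a c → c ∈ₜ t
Arc⇒∈ₜʳ _ (inj₁ (_ , q))        = inj₂ (inj₁ q)
Arc⇒∈ₜʳ _ (inj₂ (inj₁ (_ , q))) = inj₂ (inj₂ q)
Arc⇒∈ₜʳ _ (inj₂ (inj₂ (_ , q))) = inj₂ (inj₂ q)

∈ₜ-map⁻ : ∀ (f : P → Q) t {a} → a ∈ₜ mapTriple f t → ∃ λ b → f b ≡ a
∈ₜ-map⁻ f ⟨ b , _ , _ ⟩ (inj₁ refl)        = b , refl
∈ₜ-map⁻ f ⟨ _ , b , _ ⟩ (inj₂ (inj₁ refl)) = b , refl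
∈ₜ-map⁻ f ⟨ _ , _ , b ⟩ (inj₂ (inj₂ refl)) = b , refl

-- The DTS of Defs over an arbitrary point type, with triples indexed by any finite type, so that
-- the constructions below can use sums and products of point sets.
record TripleSystem (P : Set) : Set₁ where
  field
    Index       : Set
    size        : ℕ
    enumeration : Fin size ↔ Index
    triple      : Index → TransitiveTriple P
    distinct    : ∀ i → Distinct (triple i)
    unique      : ∀ {a c} → a ≢ c → ∃! _≡_ λ i → Arc (triple i) a c

open TripleSystem

module _ (D : TripleSystem P) {f : P → Q} (f-inj : Injective _≡_ _≡_ f) where

  mapped-unique : ∀ {a c} → a ≢ c → ∃! _≡_ λ i → Arc (mapTriple f (triple D i)) (f a) (f c)
  mapped-unique a≢c with unique D a≢c
  ... | i , arc , only = i , Arc-map f (triple D i) arc , only ∘ Arc-map⁻ f-inj (triple D _)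

mapPoints : P ↔ Q → TripleSystem P → TripleSystem Q
mapPoints e D = record
  { Index       = Index D
  ; size        = size D
  ; enumeration = enumeration D
  ; triple      = mapTriple to ∘ triple D
  ; distinct    = λ i → Distinct-map (↔-injective e) (triple D i) (distinct D i)
  ; unique      = λ {a} {c} a≢c → subst₂ (λ a′ c′ → ∃! _≡_ λ i → Arc (mapTriple to (triple D i)) a′ c′)
                    (strictlyInverseˡ a) (strictlyInverseˡ c)
                    (mapped-unique D (↔-injective e) (a≢c ∘ from-injective))
  }
  where
  open Inverse e
  from-injective : ∀ {a c} → from a ≡ from c → a ≡ c
  from-injective = ↔-injective (↔-sym e)

fromDTS : ∀ {v} → DTS v → TripleSystem (Fin v)
fromDTS D = record
  { Index       = Fin (DTS.b D)
  ; size        = DTS.b D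
  ; enumeration = ↔-refl
  ; triple      = λ i → ⟨ x (DTS.triple D i) , y (DTS.triple D i) , z (DTS.triple D i) ⟩
  ; distinct    = DTS.distinct D
  ; unique      = λ a≢c → let i , arc , only = DTS.exact D _ _ a≢c in i , arc , λ arc′ → sym (only _ arc′)
  }

toDTS : ∀ {v} → TripleSystem (Fin v) → DTS v
toDTS D = record
  { b        = size D
  ; triple   = λ k → let t = triple D (to k) in tt3 (source t) (middle t) (sink t)
  ; distinct = distinct D ∘ to
  ; exact    = λ a c a≢c → let i , arc , only = unique D a≢c in
      from i , subst (λ j → Arc (triple D j) a c) (sym (strictlyInverseˡ i)) arc ,
      λ k arc′ → trans (sym (strictlyInverseʳ k)) (cong from (sym (only arc′)))
  }
  where open Inverse (enumeration D)

trivialSystem : (∀ (a c : P) → a ≡ c) → TripleSystem P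
trivialSystem all-equal = record
  { Index       = Fin 0
  ; size        = 0
  ; enumeration = ↔-refl
  ; triple      = λ ()
  ; distinct    = λ ()
  ; unique      = λ a≢c → ⊥-elim (a≢c (all-equal _ _))
  }

module Cyclic (k : ℕ) where

  N : ℕ
  N = suc k

  [_] : ℕ → Fin N
  [ m ] = m mod N

  toℕ-[] : ∀ m → toℕ [ m ] ≡ m % N
  toℕ-[] m = toℕ-fromℕ< _

  []-cong : ∀ m m′ → m % N ≡ m′ % N → [ m ] ≡ [ m′ ]
  []-cong m m′ eq = toℕ-injective (trans (toℕ-[] m) (trans eq (sym (toℕ-[] m′))))

  []-toℕ : ∀ a → [ toℕ a ] ≡ a
  []-toℕ a = toℕ-injective (trans (toℕ-[] (toℕ a)) (m<n⇒m%n≡m (toℕ<n a)))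

  []-+N : ∀ m → [ m + N ] ≡ [ m ]
  []-+N m = []-cong (m + N) m ([m+n]%n≡m%n m N)

  []-absorbʳ : ∀ m n → [ m + toℕ [ n ] ] ≡ [ m + n ]
  []-absorbʳ m n = []-cong (m + toℕ [ n ]) (m + n) (begin
    (m + toℕ [ n ]) % N          ≡⟨ cong (λ r → (m + r) % N) (toℕ-[] n) ⟩
    (m + n % N) % N              ≡⟨ %-distribˡ-+ m (n % N) N ⟩
    (m % N + n % N % N) % N      ≡⟨ cong (λ r → (m % N + r) % N) (m%n%n≡m%n n N) ⟩
    (m % N + n % N) % N          ≡⟨ %-distribˡ-+ m n N ⟨
    (m + n) % N                  ∎)
    where open ≡-Reasoning

  []-absorbˡ : ∀ m n → [ toℕ [ m ] + n ] ≡ [ m + n ]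
  []-absorbˡ m n = trans (cong [_] (+-comm (toℕ [ m ]) n)) (trans ([]-absorbʳ n m) (cong [_] (+-comm n m)))

  infixl 6 _⊕_ _⊖_

  _⊕_ : Fin N → Fin N → Fin N
  a ⊕ b = [ toℕ a + toℕ b ]

  -- b ⊖ a is the difference d with a ⊕ d ≡ b; adding N ∸ a avoids truncated subtraction.
  _⊖_ : Fin N → Fin N → Fin N
  b ⊖ a = [ toℕ b + (N ∸ toℕ a) ]

  ⊕-comm : ∀ a b → a ⊕ b ≡ b ⊕ a
  ⊕-comm a b = cong [_] (+-comm (toℕ a) (toℕ b))

  ⊕-identityʳ : ∀ a → a ⊕ zero ≡ a
  ⊕-identityʳ a = trans (cong [_] (+-identityʳ (toℕ a))) ([]-toℕ a)

  private
    a+[N∸a]≡N : ∀ (a : Fin N) → toℕ a + (N ∸ toℕ a) ≡ N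
    a+[N∸a]≡N a = m+[n∸m]≡n (<⇒≤ (toℕ<n a))

  ⊕-⊖ : ∀ a b → a ⊕ (b ⊖ a) ≡ b
  ⊕-⊖ a b = begin
    [ toℕ a + toℕ [ toℕ b + (N ∸ toℕ a) ] ] ≡⟨ []-absorbʳ (toℕ a) _ ⟩
    [ toℕ a + (toℕ b + (N ∸ toℕ a)) ]       ≡⟨ cong [_] (+-comm (toℕ a) _) ⟩
    [ toℕ b + (N ∸ toℕ a) + toℕ a ]         ≡⟨ cong [_] (+-assoc (toℕ b) _ _) ⟩
    [ toℕ b + ((N ∸ toℕ a) + toℕ a) ]       ≡⟨ cong (λ r → [ toℕ b + r ]) (trans (+-comm _ (toℕ a)) (a+[N∸a]≡N a)) ⟩
    [ toℕ b + N ]                           ≡⟨ []-+N (toℕ b) ⟩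
    [ toℕ b ]                               ≡⟨ []-toℕ b ⟩
    b                                       ∎
    where open ≡-Reasoning

  ⊖-⊕ : ∀ a d → (a ⊕ d) ⊖ a ≡ d
  ⊖-⊕ a d = begin
    [ toℕ [ toℕ a + toℕ d ] + (N ∸ toℕ a) ] ≡⟨ []-absorbˡ (toℕ a + toℕ d) _ ⟩
    [ toℕ a + toℕ d + (N ∸ toℕ a) ]         ≡⟨ cong (λ r → [ r + (N ∸ toℕ a) ]) (+-comm (toℕ a) (toℕ d)) ⟩
    [ toℕ d + toℕ a + (N ∸ toℕ a) ]         ≡⟨ cong [_] (+-assoc (toℕ d) _ _) ⟩
    [ toℕ d + (toℕ a + (N ∸ toℕ a)) ]       ≡⟨ cong (λ r → [ toℕ d + r ]) (a+[N∸a]≡N a) ⟩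
    [ toℕ d + N ]                           ≡⟨ []-+N (toℕ d) ⟩
    [ toℕ d ]                               ≡⟨ []-toℕ d ⟩
    d                                       ∎
    where open ≡-Reasoning

  ⊕≡⇒≡⊖ : ∀ a d {b} → a ⊕ d ≡ b → d ≡ b ⊖ a
  ⊕≡⇒≡⊖ a d refl = sym (⊖-⊕ a d)

  ⊖≡zero⇒≡ : ∀ {a b} → b ⊖ a ≡ zero → b ≡ a
  ⊖≡zero⇒≡ {a} {b} eq = trans (sym (⊕-⊖ a b)) (trans (cong (a ⊕_) eq) (⊕-identityʳ a))

  ⊕-cancelˡ : ∀ a {d d′} → a ⊕ d ≡ a ⊕ d′ → d ≡ d′
  ⊕-cancelˡ a {d} {d′} eq = trans (⊕≡⇒≡⊖ a d eq) (⊖-⊕ a d′)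

module _ {v b : ℕ} (t : Fin b → Triple v) where

  IsDTS : Set
  IsDTS = (∀ i → DistinctTriple (t i)) × (∀ a c → a ≢ c → ExactlyOne λ i → HasEdge (t i) a c)

  isDTS? : Dec IsDTS
  isDTS? = all? (λ i → distinct? (t i)) ×-dec all? λ a → all? λ c → ¬? (a ≟ c) →-dec exactlyOne? a c
    where
    distinct? : ∀ s → Dec (DistinctTriple s)
    distinct? s = ¬? (x s ≟ y s) ×-dec ¬? (x s ≟ z s) ×-dec ¬? (y s ≟ z s)
    edge? : ∀ s a c → Dec (HasEdge s a c)
    edge? s a c = ((a ≟ x s) ×-dec (c ≟ y s)) ⊎-dec ((a ≟ x s) ×-dec (c ≟ z s))
                  ⊎-dec ((a ≟ y s) ×-dec (c ≟ z s))
    exactlyOne? : ∀ a c → Dec (ExactlyOne λ i → HasEdge (t i) a c)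
    exactlyOne? a c = any? λ i → edge? (t i) a c ×-dec all? λ j → edge? (t j) a c →-dec (j ≟ i)

  fromTriples : IsDTS → DTS v
  fromTriples (dist , exact) = record { b = b ; triple = t ; distinct = dist ; exact = exact }

dts₃ : DTS 3
dts₃ = fromTriples (lookup ts) (from-yes (isDTS? (lookup ts)))
  where ts = tt3 (# 0) (# 1) (# 2) ∷ tt3 (# 2) (# 1) (# 0) ∷ []

dts₄ : DTS 4
dts₄ = fromTriples (lookup ts) (from-yes (isDTS? (lookup ts)))
  where ts = tt3 (# 0) (# 1) (# 2) ∷ tt3 (# 1) (# 0) (# 3) ∷ tt3 (# 2) (# 3) (# 0) ∷ tt3 (# 3) (# 2) (# 1) ∷ []

dts₆ : DTS 6
dts₆ = fromTriples (lookup ts) (from-yes (isDTS? (lookup ts)))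
  where
  ts = tt3 (# 0) (# 1) (# 2) ∷ tt3 (# 0) (# 3) (# 4) ∷ tt3 (# 1) (# 0) (# 5) ∷ tt3 (# 1) (# 4) (# 3) ∷
       tt3 (# 2) (# 3) (# 0) ∷ tt3 (# 2) (# 4) (# 1) ∷ tt3 (# 3) (# 2) (# 5) ∷ tt3 (# 5) (# 3) (# 1) ∷
       tt3 (# 4) (# 5) (# 0) ∷ tt3 (# 5) (# 4) (# 2) ∷ []

-- Every row {p} × ℤ/N ∪ W carries a copy of C, so the points of W lie in all rows and W must have
-- at most one point. Arcs between different rows are covered by the transversals over triples of R.
module Product {a : ℕ} {W : Set} (W-irrelevant : ∀ (w w′ : W) → w ≡ w′) (k : ℕ)
               (R : TripleSystem (Fin a)) (C : TripleSystem (Fin (suc k) ⊎ W)) where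

  open Cyclic k

  Point : Set
  Point = (Fin a × Fin N) ⊎ W

  inRow : Fin a → Fin N ⊎ W → Point
  inRow p (inj₁ x) = inj₁ (p , x)
  inRow p (inj₂ w) = inj₂ w

  inRow-injective : ∀ p → Injective _≡_ _≡_ (inRow p)
  inRow-injective p {inj₁ _} {inj₁ _} refl = refl
  inRow-injective p {inj₂ _} {inj₂ _} refl = refl

  ∈ₜ-inRow⇒≡ : ∀ {p p′ x} t → inj₁ (p , x) ∈ₜ mapTriple (inRow p′) t → p′ ≡ p
  ∈ₜ-inRow⇒≡ {p} {p′} t x∈t with ∈ₜ-map⁻ (inRow p′) t x∈t
  ... | inj₁ _ , refl = refl

  transversal : TransitiveTriple (Fin a) → Fin N → Fin N → TransitiveTriple Point
  transversal t x y = ⟨ inj₁ (source t , x) , inj₁ (middle t , y) , inj₁ (sink t , x ⊕ y) ⟩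

  transversal-∌W : ∀ t x y {w} → ¬ (inj₂ w ∈ₜ transversal t x y)
  transversal-∌W t x y (inj₁ ())
  transversal-∌W t x y (inj₂ (inj₁ ()))
  transversal-∌W t x y (inj₂ (inj₂ ()))

  transversal-Arc⁻ : ∀ t x y {p q x′ y′} → Arc (transversal t x y) (inj₁ (p , x′)) (inj₁ (q , y′)) → Arc t p q
  transversal-Arc⁻ ⟨ _ , _ , _ ⟩ x y (inj₁ (refl , refl))        = inj₁ (refl , refl)
  transversal-Arc⁻ ⟨ _ , _ , _ ⟩ x y (inj₂ (inj₁ (refl , refl))) = inj₂ (inj₁ (refl , refl))
  transversal-Arc⁻ ⟨ _ , _ , _ ⟩ x y (inj₂ (inj₂ (refl , refl))) = inj₂ (inj₂ (refl , refl))

  -- The three coordinates x, y, x ⊕ y form a Latin square: any two of them determine the third.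
  transversal-unique : ∀ t → Distinct t → ∀ {p q} → Arc t p q → ∀ x y →
    ∃! _≡_ λ ((x′ , y′) : Fin N × Fin N) → Arc (transversal t x′ y′) (inj₁ (p , x)) (inj₁ (q , y))
  transversal-unique ⟨ _ , _ , k₃ ⟩ (p≢q , _ , q≢r) (inj₁ (refl , refl)) x y = (x , y) , inj₁ (refl , refl) , only
    where
    only : ∀ {s} → Arc (transversal _ (proj₁ s) (proj₂ s)) _ _ → (x , y) ≡ s
    only (inj₁ (refl , refl))        = refl
    only (inj₂ (inj₁ (refl , refl))) = ⊥-elim (q≢r refl)
    only (inj₂ (inj₂ (refl , refl))) = ⊥-elim (p≢q refl)
  transversal-unique ⟨ _ , _ , k₃ ⟩ (p≢q , _ , q≢r) (inj₂ (inj₁ (refl , refl))) x y =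
    (x , y ⊖ x) , inj₂ (inj₁ (refl , cong (λ w → inj₁ (k₃ , w)) (sym (⊕-⊖ x y)))) , only
    where
    only : ∀ {s} → Arc (transversal _ (proj₁ s) (proj₂ s)) _ _ → (x , y ⊖ x) ≡ s
    only (inj₁ (refl , refl))        = ⊥-elim (q≢r refl)
    only {_ , y′} (inj₂ (inj₁ (refl , refl))) = cong (x ,_) (sym (⊕≡⇒≡⊖ x y′ refl))
    only (inj₂ (inj₂ (refl , refl))) = ⊥-elim (p≢q refl)
  transversal-unique ⟨ _ , _ , k₃ ⟩ (p≢q , _ , _) (inj₂ (inj₂ (refl , refl))) x y =
    (y ⊖ x , x) ,
    inj₂ (inj₂ (refl , cong (λ w → inj₁ (k₃ , w)) (sym (trans (⊕-comm (y ⊖ x) x) (⊕-⊖ x y))))) , only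
    where
    only : ∀ {s} → Arc (transversal _ (proj₁ s) (proj₂ s)) _ _ → (y ⊖ x , x) ≡ s
    only (inj₁ (refl , refl))                = ⊥-elim (p≢q refl)
    only (inj₂ (inj₁ (refl , refl)))         = ⊥-elim (p≢q refl)
    only {x′ , _} (inj₂ (inj₂ (refl , refl))) = cong (_, x) (sym (⊕≡⇒≡⊖ x x′ (⊕-comm x x′)))

  Block : Set
  Block = (Fin a × Index C) ⊎ (Index R × Fin N × Fin N)

  block : Block → TransitiveTriple Point
  block (inj₁ (p , j))     = mapTriple (inRow p) (triple C j)
  block (inj₂ (i , x , y)) = transversal (triple R i) x y

  block-distinct : ∀ b → Distinct (block b)
  block-distinct (inj₁ (p , j))     = Distinct-map (inRow-injective p) (triple C j) (distinct C j)
  block-distinct (inj₂ (i , x , y)) with distinct R i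
  ... | p≢q , p≢r , q≢r = p≢q ∘ row-injective , p≢r ∘ row-injective , q≢r ∘ row-injective
    where
    row-injective : ∀ {p q} {x y : Fin N} → _≡_ {A = Point} (inj₁ (p , x)) (inj₁ (q , y)) → p ≡ q
    row-injective refl = refl

  UniqueBlock : Point → Point → Set
  UniqueBlock a c = ∃! _≡_ λ b → Arc (block b) a c

  withinRow : ∀ p {u u′} → u ≢ u′ →
    (∀ {p′} t → Arc (mapTriple (inRow p′) t) (inRow p u) (inRow p u′) → p′ ≡ p) →
    (∀ i x y → ¬ Arc (transversal (triple R i) x y) (inRow p u) (inRow p u′)) →
    UniqueBlock (inRow p u) (inRow p u′)
  withinRow p u≢u′ inRow-p ¬transversal with mapped-unique C (inRow-injective p) u≢u′
  ... | j , arc , only = inj₁ (p , j) , arc , only′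
    where
    only′ : ∀ {b} → Arc (block b) (inRow p _) (inRow p _) → inj₁ (p , j) ≡ b
    only′ {inj₁ (p′ , j′)} arc′ with inRow-p (triple C j′) arc′
    ... | refl = cong (λ j″ → inj₁ (p , j″)) (only arc′)
    only′ {inj₂ (i , x , y)} arc′ = ⊥-elim (¬transversal i x y arc′)

  acrossRows : ∀ {p q} → p ≢ q → ∀ x y → UniqueBlock (inj₁ (p , x)) (inj₁ (q , y))
  acrossRows p≢q x y with unique R p≢q
  ... | i , arc , only with transversal-unique (triple R i) (distinct R i) arc x y
  ... | s , arcₛ , onlyₛ = inj₂ (i , s) , arcₛ , only′
    where
    only′ : ∀ {b} → Arc (block b) (inj₁ (_ , x)) (inj₁ (_ , y)) → inj₂ (i , s) ≡ b
    only′ {inj₁ (p′ , j)} arc′ = ⊥-elim (p≢q (trans (sym (∈ₜ-inRow⇒≡ (triple C j) (Arc⇒∈ₜˡ _ arc′)))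
                                                     (∈ₜ-inRow⇒≡ (triple C j) (Arc⇒∈ₜʳ _ arc′))))
    only′ {inj₂ (i′ , x′ , y′)} arc′ with only (transversal-Arc⁻ (triple R i′) x′ y′ arc′)
    ... | refl = cong (λ s′ → inj₂ (i , s′)) (onlyₛ arc′)

  block-unique : ∀ {a c} → a ≢ c → UniqueBlock a c
  block-unique {inj₁ (p , x)} {inj₁ (q , y)} a≢c with p ≟ q
  ... | no p≢q = acrossRows p≢q x y
  ... | yes refl = withinRow p (λ { refl → a≢c refl })
                     (λ t arc → ∈ₜ-inRow⇒≡ t (Arc⇒∈ₜˡ _ arc))
                     (λ i x y arc → Arc-irreflexive _ (distinct R i) (transversal-Arc⁻ _ x y arc))
  block-unique {inj₁ (p , x)} {inj₂ w} _ = withinRow p (λ ())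
                     (λ t arc → ∈ₜ-inRow⇒≡ t (Arc⇒∈ₜˡ _ arc))
                     (λ i x y arc → transversal-∌W _ x y (Arc⇒∈ₜʳ _ arc))
  block-unique {inj₂ w} {inj₁ (q , y)} _ = withinRow q (λ ())
                     (λ t arc → ∈ₜ-inRow⇒≡ t (Arc⇒∈ₜʳ _ arc))
                     (λ i x y arc → transversal-∌W _ x y (Arc⇒∈ₜˡ _ arc))
  block-unique {inj₂ w} {inj₂ w′} a≢c = ⊥-elim (a≢c (cong inj₂ (W-irrelevant w w′)))

  system : TripleSystem Point
  system = record
    { Index       = Block
    ; size        = a * size C + size R * (N * N)
    ; enumeration = ↔-trans +↔⊎ ( ↔-trans *↔× (↔-refl ×-↔ enumeration C)
                               ⊎-↔ ↔-trans *↔× (enumeration R ×-↔ *↔×))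
    ; triple      = block
    ; distinct    = block-distinct
    ; unique      = block-unique
    }

-- The new points form ℤ/(m + 1); an arc x → x ⊕ d between them, d ≠ 0, is covered by the single
-- triple through the old point d - 1.
module Doubling {m : ℕ} (D : TripleSystem (Fin m)) where

  open Cyclic m

  Point : Set
  Point = Fin m ⊎ Fin N

  Block : Set
  Block = Index D ⊎ (Fin m × Fin N)

  block : Block → TransitiveTriple Point
  block (inj₁ j)       = mapTriple inj₁ (triple D j)
  block (inj₂ (i , x)) = ⟨ inj₂ x , inj₁ i , inj₂ (x ⊕ suc i) ⟩

  ≢⊕suc : ∀ x (i : Fin m) → x ≢ x ⊕ suc i
  ≢⊕suc x i eq with ⊕-cancelˡ x (trans (⊕-identityʳ x) eq)
  ... | ()

  block-distinct : ∀ b → Distinct (block b)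
  block-distinct (inj₁ j)       = Distinct-map inj₁-injective (triple D j) (distinct D j)
  block-distinct (inj₂ (i , x)) = (λ ()) , ≢⊕suc x i ∘ inj₂-injective , (λ ())

  old-∌inj₂ : ∀ j {x} → ¬ (inj₂ x ∈ₜ block (inj₁ j))
  old-∌inj₂ j x∈ with ∈ₜ-map⁻ inj₁ (triple D j) x∈
  ... | _ , ()

  UniqueBlock : Point → Point → Set
  UniqueBlock a c = ∃! _≡_ λ b → Arc (block b) a c

  block-unique : ∀ {a c} → a ≢ c → UniqueBlock a c
  block-unique {inj₁ i} {inj₁ i′} a≢c with mapped-unique D inj₁-injective (a≢c ∘ cong inj₁)
  ... | j , arc , only = inj₁ j , arc , only′
    where
    only′ : ∀ {b} → Arc (block b) (inj₁ i) (inj₁ i′) → inj₁ j ≡ b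
    only′ {inj₁ j′} arc′ = cong inj₁ (only arc′)
    only′ {inj₂ _} (inj₁ (() , _))
    only′ {inj₂ _} (inj₂ (inj₁ (() , _)))
    only′ {inj₂ _} (inj₂ (inj₂ (_ , ())))
  block-unique {inj₂ x} {inj₁ i} _ = inj₂ (i , x) , inj₁ (refl , refl) , only
    where
    only : ∀ {b} → Arc (block b) (inj₂ x) (inj₁ i) → inj₂ (i , x) ≡ b
    only {inj₁ j} arc = ⊥-elim (old-∌inj₂ j (Arc⇒∈ₜˡ _ arc))
    only {inj₂ _} (inj₁ (refl , refl)) = refl
    only {inj₂ _} (inj₂ (inj₁ (_ , ())))
    only {inj₂ _} (inj₂ (inj₂ (() , _)))
  block-unique {inj₁ i} {inj₂ y} _ =
    inj₂ (i , y ⊖ suc i) , inj₂ (inj₂ (refl , cong inj₂ (sym (trans (⊕-comm _ (suc i)) (⊕-⊖ (suc i) y))))) , only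
    where
    only : ∀ {b} → Arc (block b) (inj₁ i) (inj₂ y) → inj₂ (i , y ⊖ suc i) ≡ b
    only {inj₁ j} arc = ⊥-elim (old-∌inj₂ j (Arc⇒∈ₜʳ _ arc))
    only {inj₂ _} (inj₁ (() , _))
    only {inj₂ _} (inj₂ (inj₁ (() , _)))
    only {inj₂ (_ , x)} (inj₂ (inj₂ (refl , refl))) =
      cong (λ x′ → inj₂ (i , x′)) (sym (⊕≡⇒≡⊖ (suc i) x (⊕-comm (suc i) x)))
  block-unique {inj₂ x} {inj₂ y} a≢c with y ⊖ x in y⊖x
  ... | zero  = ⊥-elim (a≢c (cong inj₂ (sym (⊖≡zero⇒≡ y⊖x))))
  ... | suc i = inj₂ (i , x) , inj₂ (inj₁ (refl , cong inj₂ (trans (sym (⊕-⊖ x y)) (cong (x ⊕_) y⊖x)))) , only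
    where
    only : ∀ {b} → Arc (block b) (inj₂ x) (inj₂ y) → inj₂ (i , x) ≡ b
    only {inj₁ j} arc = ⊥-elim (old-∌inj₂ j (Arc⇒∈ₜˡ _ arc))
    only {inj₂ _} (inj₁ (_ , ()))
    only {inj₂ (i′ , _)} (inj₂ (inj₁ (refl , refl))) with trans (sym y⊖x) (sym (⊕≡⇒≡⊖ x (suc i′) refl))
    ... | refl = refl
    only {inj₂ _} (inj₂ (inj₂ (() , _)))

  system : TripleSystem Point
  system = record
    { Index       = Block
    ; size        = size D + m * N
    ; enumeration = ↔-trans +↔⊎ (enumeration D ⊎-↔ *↔×)
    ; triple      = block
    ; distinct    = block-distinct
    ; unique      = block-unique
    }

Fin≤1-irrelevant : ∀ {w} → w ≤ 1 → ∀ (i j : Fin w) → i ≡ j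
Fin≤1-irrelevant (s≤s z≤n) zero zero = refl

castSystem : ∀ {m n} → m ≡ n → TripleSystem (Fin m) → TripleSystem (Fin n)
castSystem = subst (TripleSystem ∘ Fin)

product : ∀ {a w} k → w ≤ 1 → TripleSystem (Fin a) → TripleSystem (Fin (w + suc k)) →
          TripleSystem (Fin (w + a * suc k))
product {a} {w} k w≤1 R C =
  mapPoints (↔-sym (↔-trans +↔⊎ (↔-trans (⊎-comm _ _) (*↔× ⊎-↔ ↔-refl))))
    (Product.system (Fin≤1-irrelevant w≤1) k R (mapPoints (↔-trans +↔⊎ (⊎-comm _ _)) C))

double : ∀ {m} → TripleSystem (Fin m) → TripleSystem (Fin (m + suc m))
double D = mapPoints (↔-sym +↔⊎) (Doubling.system D)

data Residue3 : ℕ → Set where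
  3q   : ∀ q → Residue3 (3 * q)
  3q+1 : ∀ q → Residue3 (1 + 3 * q)
  3q+2 : ∀ q → Residue3 (2 + 3 * q)

residue3 : ∀ n → Residue3 n
residue3 zero = 3q 0
residue3 (suc n) with residue3 n
... | 3q q   = 3q+1 q
... | 3q+1 q = 3q+2 q
... | 3q+2 q = subst Residue3 (*-suc 3 q) (3q (suc q))

data Parity : ℕ → Set where
  even : ∀ r → Parity (2 * r)
  odd  : ∀ r → Parity (1 + 2 * r)

parity : ∀ n → Parity n
parity zero = even 0
parity (suc n) with parity n
... | even r = odd r
... | odd r  = subst Parity (*-suc 2 r) (even (suc r))

systemOfOrder3+ : ∀ {w} → w ≤ 1 → TripleSystem (Fin (w + 3))
systemOfOrder3+ z≤n       = fromDTS dts₃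
systemOfOrder3+ (s≤s z≤n) = fromDTS dts₄

SystemsOfOrder3T+ : ℕ → Set₁
SystemsOfOrder3T+ T = ∀ {w} → w ≤ 1 → TripleSystem (Fin (w + 3 * T))

-- For T ≡ 0, 1 (mod 3) the systems come from three copies of a DTS(T). For T = 3q + 2 use
-- 3T + 1 = 3 (T + 1) + 1 with T + 1 ≡ 0, and 3T = 6 (3r + 1) if q = 2r, 3T = 2 (9r + 7) + 1 if q = 2r + 1.
systemsOfOrder3T+ : ∀ T → SystemsOfOrder3T+ T
systemsOfOrder3T+ = <-rec SystemsOfOrder3T+ step
  where
  threefold : ∀ {T w} → w ≤ 1 → TripleSystem (Fin T) → TripleSystem (Fin (w + 3 * T))
  threefold {T} {w} w≤1 D = castSystem (cong (w +_) (*-comm T 3)) (product 2 w≤1 D (systemOfOrder3+ w≤1))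

  sixfold : ∀ r → 6 * suc (3 * r) ≡ 3 * (2 + 3 * (2 * r))
  sixfold = solve-∀

  doubled : ∀ r → let m = 1 + 3 * (2 + 3 * r) in m + suc m ≡ 3 * (2 + 3 * (1 + 2 * r))
  doubled = solve-∀

  step : ∀ T → (∀ {T′} → T′ ℕ.< T → SystemsOfOrder3T+ T′) → SystemsOfOrder3T+ T
  step T rec {w} w≤1 with residue3 T
  ... | 3q zero    = castSystem (sym (+-identityʳ w)) (trivialSystem (Fin≤1-irrelevant w≤1))
  ... | 3q (suc q) = threefold w≤1 (rec (m<m+n (suc q) (s≤s z≤n)) z≤n)
  ... | 3q+1 q     = threefold w≤1 (rec (s≤s (m≤n*m q 3)) (s≤s z≤n))
  ... | 3q+2 q with w≤1
  ...   | s≤s z≤n = product (1 + 3 * q) (s≤s z≤n) (fromDTS dts₃)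
                      (castSystem (*-suc 3 q) (rec (s≤s (s≤s (m≤n*m q 3))) z≤n))
  ...   | z≤n with parity q
  ...     | even r = castSystem (sixfold r)
                       (product (3 * r) z≤n (fromDTS dts₆)
                         (rec (s≤s (m≤n⇒m≤1+n (≤-trans (m≤n*m r 2) (m≤n*m (2 * r) 3)))) (s≤s z≤n)))
  ...     | odd r  = castSystem (doubled r) (double (rec (+-monoʳ-< 2 (*-monoʳ-< 3 (s≤s (m≤n*m r 2)))) (s≤s z≤n)))

systemOfAdmissibleOrder : ∀ {n} → n % 3 ≡ 0 ⊎ n % 3 ≡ 1 → TripleSystem (Fin n)
systemOfAdmissibleOrder {n} residue = castSystem n≡ (systemsOfOrder3T+ (n / 3) (remainder≤1 residue))
  where
  remainder≤1 : n % 3 ≡ 0 ⊎ n % 3 ≡ 1 → n % 3 ≤ 1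
  remainder≤1 (inj₁ eq) = subst (_≤ 1) (sym eq) z≤n
  remainder≤1 (inj₂ eq) = subst (_≤ 1) (sym eq) (s≤s z≤n)
  n≡ : n % 3 + 3 * (n / 3) ≡ n
  n≡ = trans (cong (n % 3 +_) (*-comm 3 (n / 3))) (sym (m≡m%n+[m/n]*n n 3))

Member : ∀ {v} → Subset v → Set
Member {v} s = Σ (Fin v) (_∈ s)

Member-injective : ∀ {v} {s : Subset v} → Injective _≡_ _≡_ (proj₁ {B = _∈ s})
Member-injective {x = p , p∈s} {y = .p , p∈s′} refl = cong (p ,_) ([]=-irrelevant p∈s p∈s′)

enumerateSubset : ∀ {v} (s : Subset v) → Fin ∣ s ∣ ↔ Member s
enumerateSubset []          = mk↔ₛ′ (λ ()) (λ ()) (λ ()) (λ ())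
enumerateSubset (true ∷ s)  = mk↔ₛ′ to from to∘from from∘to
  where
  open Inverse (enumerateSubset s) renaming (to to to′; from to from′)
  to : Fin (suc ∣ s ∣) → Member (true ∷ s)
  to zero    = zero , here
  to (suc i) = let p , p∈s = to′ i in suc p , there p∈s
  from : Member (true ∷ s) → Fin (suc ∣ s ∣)
  from (zero , here)          = zero
  from (suc p , there p∈s)    = suc (from′ (p , p∈s))
  to∘from : ∀ m → to (from m) ≡ m
  to∘from (zero , here)       = refl
  to∘from (suc p , there p∈s) = cong (λ { (q , q∈s) → suc q , there q∈s }) (strictlyInverseˡ (p , p∈s))
  from∘to : ∀ i → from (to i) ≡ i
  from∘to zero    = refl
  from∘to (suc i) = cong suc (strictlyInverseʳ i)
enumerateSubset (false ∷ s) = mk↔ₛ′ to from to∘from strictlyInverseʳ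
  where
  open Inverse (enumerateSubset s) renaming (to to to′; from to from′)
  to : Fin ∣ s ∣ → Member (false ∷ s)
  to i = let p , p∈s = to′ i in suc p , there p∈s
  from : Member (false ∷ s) → Fin ∣ s ∣
  from (suc p , there p∈s) = from′ (p , p∈s)
  to∘from : ∀ m → to (from m) ≡ m
  to∘from (suc p , there p∈s) = cong (λ { (q , q∈s) → suc q , there q∈s }) (strictlyInverseˡ (p , p∈s))

Σ-enumeration : ∀ {b} {A : Fin b → Set} (n : Fin b → ℕ) → (∀ i → Fin (n i) ↔ A i) →
                Fin (foldr _+_ 0 n) ↔ Σ (Fin b) A
Σ-enumeration {zero}  n e = mk↔ₛ′ (λ ()) (λ ()) (λ ()) (λ ())
Σ-enumeration {suc b} {A} n e = ↔-trans +↔⊎ (↔-trans (e zero ⊎-↔ Σ-enumeration (n ∘ suc) (e ∘ suc)) split)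
  where
  split : (A zero ⊎ Σ (Fin b) (A ∘ suc)) ↔ Σ (Fin (suc b)) A
  split = mk↔ₛ′ (λ { (inj₁ x) → zero , x ; (inj₂ (i , x)) → suc i , x })
                (λ { (zero , x) → inj₁ x ; (suc i , x) → inj₂ (i , x) })
                (λ { (zero , x) → refl ; (suc i , x) → refl })
                (λ { (inj₁ x) → refl ; (inj₂ (i , x)) → refl })

module Gluing {v} {K : ℕ → Set} (D : PBD v K) (S : ∀ i → TripleSystem (Member (PBD.block D i))) where

  open PBD D using (block) renaming (b to blocks; exact to pair-in-unique-block)

  ∈ₜ⇒∈block : ∀ i j {a} → a ∈ₜ mapTriple proj₁ (triple (S i) j) → a ∈ block i
  ∈ₜ⇒∈block i j a∈ with ∈ₜ-map⁻ proj₁ (triple (S i) j) a∈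
  ... | (_ , a∈block) , refl = a∈block

  glued-unique : ∀ {a c} → a ≢ c →
    ∃! _≡_ λ ((i , j) : Σ (Fin blocks) (Index ∘ S)) → Arc (mapTriple proj₁ (triple (S i) j)) a c
  glued-unique {a} {c} a≢c with pair-in-unique-block a c a≢c
  ... | i , (a∈ , c∈) , only-block with mapped-unique (S i) Member-injective {a , a∈} {c , c∈} (a≢c ∘ cong proj₁)
  ...   | j , arc , only = (i , j) , arc , only′
    where
    only′ : ∀ {ij} → Arc (mapTriple proj₁ (triple (S (proj₁ ij)) (proj₂ ij))) a c → (i , j) ≡ ij
    only′ {i′ , j′} arc′
      with only-block i′ (∈ₜ⇒∈block i′ j′ (Arc⇒∈ₜˡ _ arc′) , ∈ₜ⇒∈block i′ j′ (Arc⇒∈ₜʳ _ arc′))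
    ... | refl = cong (i ,_) (only arc′)

  system : TripleSystem (Fin v)
  system = record
    { Index       = Σ (Fin blocks) (Index ∘ S)
    ; size        = foldr _+_ 0 (size ∘ S)
    ; enumeration = Σ-enumeration (size ∘ S) (enumeration ∘ S)
    ; triple      = λ (i , j) → mapTriple proj₁ (triple (S i) j)
    ; distinct    = λ (i , j) → Distinct-map Member-injective (triple (S i) j) (distinct (S i) j)
    ; unique      = glued-unique
    }

injective⇒surjective : ∀ {k} {f : Fin k → Fin k} → Injective _≡_ _≡_ f → ∀ y → ∃ λ x → f x ≡ y
injective⇒surjective {suc k} {f} f-injective y with any? (λ x → f x ≟ y)
... | yes hit = hit
... | no miss = contradiction (injective⇒≤ skip-y-injective) (1+n≰n {k})
  where
  y≢f : ∀ x → y ≢ f x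
  y≢f x = miss ∘ (x ,_) ∘ sym
  skip-y : Fin (suc k) → Fin k
  skip-y x = punchOut (y≢f x)
  skip-y-injective : Injective _≡_ _≡_ skip-y
  skip-y-injective {x} {x′} eq = f-injective (punchOut-injective (y≢f x) (y≢f x′) eq)

-- Ranking the points of a block by the positions σ gives them, i.e. counting the points placed
-- earlier, turns the restriction of σ into a sequencing of the block.
module Ranking {k v} (pos : Fin k → Fin v) (pos-injective : Injective _≡_ _≡_ pos) where

  below : Fin k → Subset k
  below i = tabulate λ j → does (pos j <? pos i)

  ∈below⇒ : ∀ {i j} → j ∈ below i → pos j < pos i
  ∈below⇒ {i} {j} j∈ =
    invert (subst (Reflects _) (trans (sym (lookup∘tabulate _ j)) ([]=⇒lookup j∈)) (proof (pos j <? pos i)))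

  ⇒∈below : ∀ {i j} → pos j < pos i → j ∈ below i
  ⇒∈below {i} {j} lt = lookup⇒[]= j (below i) (trans (lookup∘tabulate _ j) (dec-true (pos j <? pos i) lt))

  ∉below : ∀ i → i ∉ below i
  ∉below i = <-irrefl refl ∘ ∈below⇒

  rank : Fin k → Fin k
  rank i = fromℕ< (subst (∣ below i ∣ ℕ.<_) (∣⊤∣≡n k) (p⊂q⇒∣p∣<∣q∣ (⊆⊤ , i , ∈⊤ , ∉below i)))

  rank-monotone : ∀ {i j} → pos i < pos j → rank i < rank j
  rank-monotone {i} {j} lt = subst₂ ℕ._<_ (sym (toℕ-fromℕ< _)) (sym (toℕ-fromℕ< _))
    (p⊂q⇒∣p∣<∣q∣ ((λ l∈ → ⇒∈below (<-trans (∈below⇒ l∈) lt)) , i , ⇒∈below lt , ∉below i))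

  rank-reflects : ∀ {i j} → rank i < rank j → pos i < pos j
  rank-reflects {i} {j} lt with <-cmp (pos i) (pos j)
  ... | tri< pi<pj _ _ = pi<pj
  ... | tri≈ _ pi≡pj _ = contradiction (subst (λ l → rank i < rank l) (sym (pos-injective pi≡pj)) lt) (<-irrefl refl)
  ... | tri> _ _ pj<pi = contradiction (rank-monotone pj<pi) (<-asym lt)

  rank-injective : Injective _≡_ _≡_ rank
  rank-injective {i} {j} eq with <-cmp (pos i) (pos j)
  ... | tri< pi<pj _ _ = contradiction eq (<⇒≢ (rank-monotone pi<pj))
  ... | tri≈ _ pi≡pj _ = pos-injective pi≡pj
  ... | tri> _ _ pj<pi = contradiction (sym eq) (<⇒≢ (rank-monotone pj<pi))

  ranking : Permutation′ k
  ranking = ↔-sym (⤖⇒↔ (mk⤖ (rank-injective , strictlySurjective⇒surjective (injective⇒surjective rank-injective))))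

EmbedsVia : ∀ {k v} → (Fin k → Fin v) → DTS k → DTS v → Set
EmbedsVia f E D = ∀ j → ∃ λ i → let s = DTS.triple E j ; t = DTS.triple D i in
  (x t ≡ f (x s)) × (y t ≡ f (y s)) × (z t ≡ f (z s))

noGoodSequencing-lifts : ∀ {k v} (E : DTS k) (D : DTS v) (f : Fin k → Fin v) → Injective _≡_ _≡_ f →
  EmbedsVia f E D → (∀ τ → ¬ GoodSequencing E τ) → ∀ σ → ¬ GoodSequencing D σ
noGoodSequencing-lifts E D f f-injective embeds E-bad σ σ-good = E-bad ranking ranking-good
  where
  pos : Fin _ → Fin _
  pos = (σ ⟨$⟩ˡ_) ∘ f
  open Ranking pos (f-injective ∘ ↔-injective (↔-sym σ))
  moved : ∀ {a b a′ b′} → a′ ≡ f a → b′ ≡ f b → ranking ⟨$⟩ˡ a < ranking ⟨$⟩ˡ b → σ ⟨$⟩ˡ a′ < σ ⟨$⟩ˡ b′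
  moved refl refl = rank-reflects
  ranking-good : GoodSequencing E ranking
  ranking-good j (x<y , y<z) with embeds j
  ... | i , x≡ , y≡ , z≡ = σ-good i (moved x≡ y≡ x<y , moved y≡ z≡ y<z)

toDTS-embeds : ∀ {k v} (E : DTS k) (G : TripleSystem (Fin v)) (f : Fin k → Fin v) →
  (∀ j → ∃ λ i → triple G i ≡ mapTriple f (triple (fromDTS E) j)) → EmbedsVia f E (toDTS G)
toDTS-embeds E G f embeds j with embeds j
... | i , eq = from i , cong source eq′ , cong middle eq′ , cong sink eq′
  where
  open Inverse (enumeration G)
  eq′ : triple G (to (from i)) ≡ mapTriple f (triple (fromDTS E) j)
  eq′ = trans (cong (triple G) (strictlyInverseˡ i)) eq

subsetEmbedding : ∀ {v} (s : Subset v) → Fin ∣ s ∣ → Fin v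
subsetEmbedding s = proj₁ ∘ Inverse.to (enumerateSubset s)

subsetEmbedding-injective : ∀ {v} (s : Subset v) → Injective _≡_ _≡_ (subsetEmbedding s)
subsetEmbedding-injective s = ↔-injective (enumerateSubset s) ∘ Member-injective

DTS-on-block-extends : ∀ {v} (P : PBD v InL) i₀ (E : DTS ∣ PBD.block P i₀ ∣) →
  Σ (DTS v) (EmbedsVia (subsetEmbedding (PBD.block P i₀)) E)
DTS-on-block-extends P i₀ E = toDTS glued , toDTS-embeds E glued (subsetEmbedding (block i₀)) E-inside
  where
  open PBD P using (block; sizeK)
  E′ : TripleSystem (Member (block i₀))
  E′ = mapPoints (enumerateSubset (block i₀)) (fromDTS E)
  S : ∀ i → TripleSystem (Member (block i))
  S i with i ≟ i₀
  ... | yes refl = E′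
  ... | no _     = mapPoints (enumerateSubset (block i)) (systemOfAdmissibleOrder (proj₂ (sizeK i)))
  S-i₀ : ∀ j → ∃ λ j′ → triple (S i₀) j′ ≡ triple E′ j
  S-i₀ j with i₀ ≟ i₀
  ... | yes refl = j , refl
  ... | no i₀≢i₀ = contradiction refl i₀≢i₀
  glued : TripleSystem (Fin _)
  glued = Gluing.system P S
  E-inside : ∀ j → ∃ λ i → triple glued i ≡ mapTriple (subsetEmbedding (block i₀)) (triple (fromDTS E) j)
  E-inside j = let j′ , eq = S-i₀ j in (i₀ , j′) , cong (mapTriple proj₁) eq

theorem5p3 : (v : ℕ) (P : PBD v InL) →
    Σ (Fin (PBD.b P)) (λ i → InKstar ∣ PBD.block P i ∣) →
    InKstar v
theorem5p3 v P (i₀ , k≥3 , E , E-bad) with DTS-on-block-extends P i₀ E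
... | D , E↪D = ≤-trans k≥3 (∣p∣≤n B₀) , D ,
                noGoodSequencing-lifts E D (subsetEmbedding B₀) (subsetEmbedding-injective B₀) E↪D E-bad
  where
  B₀ : Subset v
  B₀ = PBD.block P i₀
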